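{- Let $l\ge1$, let $\sigma:\{x_0,\dots,x_{l-1}\}\to\{0,1\}$ be a Boolean valuation and $s_\sigma$ the corresponding $l$-switching of $\mathcal S_l$. Then for every propositional formula $\zeta$ in negation normal form over $x_0,\dots,x_{l-1}$: $\sigma(\zeta)=1$ iff $\mathcal S_l,s_\sigma\models\zeta^p$ iff $\mathcal S_l,s_\sigma\not\models\zeta^n$; and $\sigma(\zeta)=0$ iff $\mathcal S_l,s_\sigma\models\zeta^n$ iff $\mathcal S_l,s_\sigma\not\models\zeta^p$.
   Context: Inquisitive propositional formulas: $\phi::=\bot\mid p\mid \phi\land\phi\mid \phi\vee\!\!\!\vee\phi\mid\phi\to\phi$ ($\vee\!\!\!\vee$ is inquisitive disjunction), with $\neg\phi:=\phi\to\bot$. For a model $M=(W,V)$ and a state $s\subseteq W$: $M,s\models\bot$ iff $s=\emptyset$; $M,s\models p$ iff $s\subseteq V(p)$; $\land$ is componentwise; $M,s\models\phi\vee\!\!\!\vee\psi$ iff $M,s\models\phi$ or $M,s\models\psi$; $M,s\models\phi\to\psi$ iff for all $t\subseteq s$, $M,t\models\phi$ implies $M,t\models\psi$. The switching model $\mathcal S_l=(W_l,V_l)$ over atoms $p_0,\dots,p_{l-1},q_0,\dots,q_{l-1}$ has $W_l=\{w_0^+,w_0^-,\dots,w_{l-1}^+,w_{l-1}^-\}$, $V_l(p_i)=\{w_i^+\}$, $V_l(q_i)=\{w_i^+,w_i^-\}$. For a Boolean valuation $\sigma$ on $\{x_0,\dots,x_{k-1}\}$ ($k\le l$), $s_\sigma$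 is the state containing, for $i<k$, $w_i^+$ if $\sigma(x_i)=1$ and $w_i^-$ if $\sigma(x_i)=0$ (and not the other), and containing both $w_i^+,w_i^-$ for $k\le i<l$ (the $k$-switching corresponding to $\sigma$). Negation normal form: built from literals $x_i,\neg x_i$ by $\land,\vee$. Translations: $(x_i)^p:=q_i\to p_i$, $(x_i)^n:=q_i\to\neg p_i$, $(\neg x_i)^p:=q_i\to\neg p_i$, $(\neg x_i)^n:=q_i\to p_i$, $(\zeta\land\xi)^p:=\zeta^p\land\xi^p$, $(\zeta\land\xi)^n:=\zeta^n\vee\!\!\!\vee\xi^n$, $(\zeta\vee\xi)^p:=\zeta^p\vee\!\!\!\vee\xi^p$, $(\zeta\vee\xi)^n:=\zeta^n\land\xi^n$. -}

module Defs where

open import Data.Bool using (Bool; true; false; not; if_then_else_; T; _∧_; _∨_)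
open import Data.Sum using (_⊎_)
open import Relation.Nullary.Decidable.Core using (does)
open import Data.Fin using (Fin; _≟_)
open import Data.Nat using (ℕ)
open import Data.Product using (_×_; _,_)
open import Data.Empty using (⊥)

data IForm (A : Set) : Set where
  ⊥ᵢ   : IForm A
  atom : A → IForm A
  _∧ᵢ_ : IForm A → IForm A → IForm A
  _⩔_  : IForm A → IForm A → IForm A
  _⇒ᵢ_ : IForm A → IForm A → IForm A

¬ᵢ_ : {A : Set} → IForm A → IForm A
¬ᵢ φ = φ ⇒ᵢ ⊥ᵢ

-- A model: set of worlds W and valuation V (V a w = true iff w ∈ V(a))
record Model (A : Set) : Set₁ where
  field
    W : Set
    V : A → W → Bool
open Model public

-- States: (decidable) subsets of W, given by characteristic functions
State : {A : Set} → Model A → Set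
State M = W M → Bool

_⊆ₛ_ : {A : Set} {M : Model A} → State M → State M → Set
_⊆ₛ_ {M = M} t s = (w : W M) → T (t w) → T (s w)

_,_⊨_ : {A : Set} (M : Model A) → State M → IForm A → Set
M , s ⊨ ⊥ᵢ = (w : W M) → T (s w) → ⊥
M , s ⊨ atom a = (w : W M) → T (s w) → T (V M a w)
M , s ⊨ (φ ∧ᵢ ψ) = (M , s ⊨ φ) × (M , s ⊨ ψ)
M , s ⊨ (φ ⩔ ψ) = (M , s ⊨ φ) ⊎ (M , s ⊨ ψ)
M , s ⊨ (φ ⇒ᵢ ψ) = (t : State M) → _⊆ₛ_ {M = M} t s → M , t ⊨ φ → M , t ⊨ ψ

data Atom (l : ℕ) : Set where
  p : Fin l → Atom l
  q : Fin l → Atom l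

-- Switching model S_l : worlds (i , true) = w_i^+, (i , false) = w_i^-
Switching : (l : ℕ) → Model (Atom l)
Switching l = record { W = Fin l × Bool ; V = val }
  where
  val : Atom l → Fin l × Bool → Bool
  val (p i) (j , b) = if does (i ≟ j) then b else false
  val (q i) (j , b) = does (i ≟ j)

switching : {l : ℕ} → (Fin l → Bool) → State (Switching l)
switching σ (i , b) = if b then σ i else not (σ i)

data NNF (l : ℕ) : Set where
  pos  : Fin l → NNF l
  neg  : Fin l → NNF l
  _∧ₙ_ : NNF l → NNF l → NNF l
  _∨ₙ_ : NNF l → NNF l → NNF l

eval : {l : ℕ} → (Fin l → Bool) → NNF l → Bool
eval σ (pos i) = σ i
eval σ (neg i) = not (σ i)
eval σ (ζ ∧ₙ ξ) = eval σ ζ ∧ eval σ ξ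
eval σ (ζ ∨ₙ ξ) = eval σ ζ ∨ eval σ ξ

mutual
  trP : {l : ℕ} → NNF l → IForm (Atom l)
  trP (pos i) = atom (q i) ⇒ᵢ atom (p i)
  trP (neg i) = atom (q i) ⇒ᵢ (¬ᵢ atom (p i))
  trP (ζ ∧ₙ ξ) = trP ζ ∧ᵢ trP ξ
  trP (ζ ∨ₙ ξ) = trP ζ ⩔ trP ξ

  trN : {l : ℕ} → NNF l → IForm (Atom l)
  trN (pos i) = atom (q i) ⇒ᵢ (¬ᵢ atom (p i))
  trN (neg i) = atom (q i) ⇒ᵢ atom (p i)
  trN (ζ ∧ₙ ξ) = trN ζ ⩔ trN ξ
  trN (ζ ∨ₙ ξ) = trN ζ ∧ᵢ trN ξ

{-# OPTIONS --safe #-}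
module Submission where

-- A substate of s_σ that supports q_i can contain no world but w_i^σ(i), so by
-- persistence s_σ supports q_i → φ exactly when the singleton {w_i^σ(i)} supports φ.
-- Since p_i holds at w_i^σ(i) iff σ(i) = 1, the translations of literals are
-- supported exactly when the literal is true (for ζ^p) or false (for ζ^n). Induction
-- on ζ, with De Morgan for ζ^n, extends this to every ζ, and as σ(ζ) is either 1 or 0
-- the two translations are complementary at s_σ.

open import Defs
open import Data.Nat using (ℕ; _≤_)
open import Data.Fin using (Fin)
open import Data.Bool using (Bool; true; false)
open import Data.Product using (_×_)
open import Relation.Binary.PropositionalEquality using (_≡_)
open import Relation.Nullary using (¬_)
open import Function.Bundles using (_⇔_)

open import Data.Bool using (T; not)
import Data.Bool.Properties as Bool
open import Data.Bool.Properties using (T-≡; T-not-≡; T-∧; T-∨; not-involutive)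
open import Algebra.Lattice.Properties.BooleanAlgebra Bool.∨-∧-booleanAlgebra using (deMorgan₁; deMorgan₂)
open import Data.Empty using (⊥-elim)
import Data.Fin.Properties as Fin
open import Data.Product using (_,_; swap)
import Data.Product as Product
open import Data.Product.Function.NonDependent.Propositional using (_×-⇔_)
open import Data.Product.Properties using (≡-dec)
import Data.Sum as Sum
open import Data.Sum.Function.Propositional using (_⊎-⇔_)
open import Function.Base using (id; _∘_)
open import Function.Bundles using (mk⇔; module Equivalence)
open import Function.Construct.Composition using (_⇔-∘_)
open import Function.Construct.Symmetry using (⇔-sym)
open import Function.Related.Propositional using (module EquationalReasoning)
open import Relation.Binary.Definitions using (DecidableEquality)
open import Relation.Binary.PropositionalEquality using (refl; sym; cong)
open import Relation.Nullary using (Dec; yes; no; does)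
open import Relation.Nullary.Decidable using (dec-true)

open Equivalence using (to; from)

T-does : {A : Set} (a? : Dec A) → T (does a?) ⇔ A
T-does (yes a) = mk⇔ (λ _ → a) _
T-does (no ¬a) = mk⇔ (λ ()) ¬a

T-not⇔¬T : {b : Bool} → T (not b) ⇔ (¬ T b)
T-not⇔¬T {true}  = mk⇔ (λ ()) (λ ¬⊤ → ¬⊤ _)
T-not⇔¬T {false} = mk⇔ (λ _ ()) _

complementary : {P N : Set} (b : Bool) → T b ⇔ P → T (not b) ⇔ N → (P ⇔ (¬ N)) × (N ⇔ (¬ P))
complementary {P} {N} true b⇔P ¬b⇔N =
  mk⇔ (λ _ → noN) (λ _ → yesP) , mk⇔ (⊥-elim ∘ noN) (λ ¬P → ⊥-elim (¬P yesP))
  where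
  yesP : P
  yesP = to b⇔P _
  noN : ¬ N
  noN = from ¬b⇔N
complementary false b⇔P ¬b⇔N = swap (complementary true ¬b⇔N b⇔P)

persistence : {A : Set} (M : Model A) (φ : IForm A) {s t : State M} →
              _⊆ₛ_ {M = M} t s → M , s ⊨ φ → M , t ⊨ φ
persistence M ⊥ᵢ       t⊆s s⊨⊥ w = s⊨⊥ w ∘ t⊆s w
persistence M (atom a) t⊆s s⊨a w = s⊨a w ∘ t⊆s w
persistence M (φ ∧ᵢ ψ) t⊆s = Product.map (persistence M φ t⊆s) (persistence M ψ t⊆s)
persistence M (φ ⩔ ψ)  t⊆s = Sum.map (persistence M φ t⊆s) (persistence M ψ t⊆s)
persistence M (φ ⇒ᵢ ψ) t⊆s s⊨φ⇒ψ u u⊆t = s⊨φ⇒ψ u (λ w → t⊆s w ∘ u⊆t w)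

module Singleton {A : Set} (M : Model A) (_≟_ : DecidableEquality (W M)) where

  ｛_｝ : W M → State M
  ｛ w ｝ v = does (w ≟ v)

  ∈-｛｝ : {w v : W M} → T (｛ w ｝ v) ⇔ w ≡ v
  ∈-｛｝ {w} {v} = T-does (w ≟ v)

  ｛｝-⊆ : {w : W M} {s : State M} → T (s w) → _⊆ₛ_ {M = M} ｛ w ｝ s
  ｛｝-⊆ w∈s v v∈｛w｝ with to ∈-｛｝ v∈｛w｝
  ... | refl = w∈s

  ⊨atom-｛｝ : {w : W M} {a : A} → M , ｛ w ｝ ⊨ atom a ⇔ T (V M a w)
  ⊨atom-｛｝ {w} {a} = mk⇔ (λ ｛w｝⊨a → ｛w｝⊨a w (from ∈-｛｝ refl)) w⊨a⇒｛w｝⊨a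
    where
    w⊨a⇒｛w｝⊨a : T (V M a w) → M , ｛ w ｝ ⊨ atom a
    w⊨a⇒｛w｝⊨a w⊨a v v∈｛w｝ with to ∈-｛｝ v∈｛w｝
    ... | refl = w⊨a

  ⊨¬atom-｛｝ : {w : W M} {a : A} → M , ｛ w ｝ ⊨ (¬ᵢ atom a) ⇔ (¬ T (V M a w))
  ⊨¬atom-｛｝ {w} {a} = mk⇔ ｛w｝⊨¬a⇒w⊭a w⊭a⇒｛w｝⊨¬a
    where
    ｛w｝⊨¬a⇒w⊭a : M , ｛ w ｝ ⊨ (¬ᵢ atom a) → ¬ T (V M a w)
    ｛w｝⊨¬a⇒w⊭a ｛w｝⊨¬a w⊨a =
      ｛w｝⊨¬a ｛ w ｝ (λ _ → id) (from ⊨atom-｛｝ w⊨a) w (from ∈-｛｝ refl)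
    w⊭a⇒｛w｝⊨¬a : ¬ T (V M a w) → M , ｛ w ｝ ⊨ (¬ᵢ atom a)
    w⊭a⇒｛w｝⊨¬a w⊭a u u⊆｛w｝ u⊨a v v∈u with to ∈-｛｝ (u⊆｛w｝ v v∈u)
    ... | refl = w⊭a (u⊨a w v∈u)

module _ {l : ℕ} where

  _≟ʷ_ : DecidableEquality (Fin l × Bool)
  _≟ʷ_ = ≡-dec Fin._≟_ Bool._≟_

  open Singleton (Switching l) _≟ʷ_
  open EquationalReasoning

  V-p-at : (i : Fin l) (b : Bool) → V (Switching l) (p i) (i , b) ≡ b
  V-p-at i b rewrite dec-true (i Fin.≟ i) refl = refl

  ∈-switching : (σ : Fin l → Bool) (i : Fin l) → T (switching σ (i , σ i))
  ∈-switching σ i with σ i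
  ... | true  = _
  ... | false = _

  ∈-switching⁻ : (σ : Fin l → Bool) {i : Fin l} {b : Bool} → T (switching σ (i , b)) → b ≡ σ i
  ∈-switching⁻ σ {b = true}  σi = sym (to T-≡ σi)
  ∈-switching⁻ σ {b = false} ¬σi = sym (to T-not-≡ ¬σi)

  ⊨q⇒⊆｛｝ : (σ : Fin l → Bool) (i : Fin l) {t : State (Switching l)} →
            _⊆ₛ_ {M = Switching l} t (switching σ) → Switching l , t ⊨ atom (q i) →
            _⊆ₛ_ {M = Switching l} t ｛ i , σ i ｝
  ⊨q⇒⊆｛｝ σ i t⊆s t⊨q (j , b) w∈t
    with to (T-does (i Fin.≟ j)) (t⊨q _ w∈t) | ∈-switching⁻ σ (t⊆s _ w∈t)
  ... | refl | refl = from (∈-｛｝ {i , σ i}) refl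

  switching-⊨q⇒ : (σ : Fin l → Bool) (i : Fin l) (φ : IForm (Atom l)) →
                  Switching l , switching σ ⊨ (atom (q i) ⇒ᵢ φ) ⇔ Switching l , ｛ i , σ i ｝ ⊨ φ
  switching-⊨q⇒ σ i φ = mk⇔
    (λ s⊨q⇒φ → s⊨q⇒φ ｛ i , σ i ｝ (｛｝-⊆ (∈-switching σ i)) ｛w｝⊨q)
    (λ ｛w｝⊨φ t t⊆s t⊨q → persistence (Switching l) φ (⊨q⇒⊆｛｝ σ i t⊆s t⊨q) ｛w｝⊨φ)
    where
    ｛w｝⊨q : Switching l , ｛ i , σ i ｝ ⊨ atom (q i)
    ｛w｝⊨q = from (⊨atom-｛｝ {i , σ i} {q i}) (from (T-does (i Fin.≟ i)) refl)

  switching-⊨q⇒p : (σ : Fin l → Bool) (i : Fin l) →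
                   T (σ i) ⇔ Switching l , switching σ ⊨ (atom (q i) ⇒ᵢ atom (p i))
  switching-⊨q⇒p σ i = ⇔-sym (begin
    Switching l , switching σ ⊨ (atom (q i) ⇒ᵢ atom (p i))  ∼⟨ switching-⊨q⇒ σ i (atom (p i)) ⟩
    Switching l , ｛ i , σ i ｝ ⊨ atom (p i)                 ∼⟨ ⊨atom-｛｝ {i , σ i} {p i} ⟩
    T (V (Switching l) (p i) (i , σ i))                    ≡⟨ cong T (V-p-at i (σ i)) ⟩
    T (σ i)                                                ∎)

  switching-⊨q⇒¬p : (σ : Fin l → Bool) (i : Fin l) →
                    T (not (σ i)) ⇔ Switching l , switching σ ⊨ (atom (q i) ⇒ᵢ (¬ᵢ atom (p i)))
  switching-⊨q⇒¬p σ i = ⇔-sym (begin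
    Switching l , switching σ ⊨ (atom (q i) ⇒ᵢ (¬ᵢ atom (p i)))  ∼⟨ switching-⊨q⇒ σ i (¬ᵢ atom (p i)) ⟩
    Switching l , ｛ i , σ i ｝ ⊨ (¬ᵢ atom (p i))                 ∼⟨ ⊨¬atom-｛｝ {i , σ i} {p i} ⟩
    (¬ T (V (Switching l) (p i) (i , σ i)))                      ≡⟨ cong (¬_ ∘ T) (V-p-at i (σ i)) ⟩
    (¬ T (σ i))                                                  ∼⟨ ⇔-sym (T-not⇔¬T {σ i}) ⟩
    T (not (σ i))                                                ∎)

module _ {l : ℕ} (σ : Fin l → Bool) where

  switching-⊨trP : (ζ : NNF l) → T (eval σ ζ) ⇔ Switching l , switching σ ⊨ trP ζ
  switching-⊨trP (pos i)  = switching-⊨q⇒p σ i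
  switching-⊨trP (neg i)  = switching-⊨q⇒¬p σ i
  switching-⊨trP (ζ ∧ₙ ξ) = (switching-⊨trP ζ ×-⇔ switching-⊨trP ξ) ⇔-∘ T-∧
  switching-⊨trP (ζ ∨ₙ ξ) = (switching-⊨trP ζ ⊎-⇔ switching-⊨trP ξ) ⇔-∘ T-∨

  switching-⊨trN : (ζ : NNF l) → T (not (eval σ ζ)) ⇔ Switching l , switching σ ⊨ trN ζ
  switching-⊨trN (pos i) = switching-⊨q⇒¬p σ i
  switching-⊨trN (neg i) rewrite not-involutive (σ i) = switching-⊨q⇒p σ i
  switching-⊨trN (ζ ∧ₙ ξ) rewrite deMorgan₁ (eval σ ζ) (eval σ ξ) =
    (switching-⊨trN ζ ⊎-⇔ switching-⊨trN ξ) ⇔-∘ T-∨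
  switching-⊨trN (ζ ∨ₙ ξ) rewrite deMorgan₂ (eval σ ζ) (eval σ ξ) =
    (switching-⊨trN ζ ×-⇔ switching-⊨trN ξ) ⇔-∘ T-∧

lemma4p5 : (l : ℕ) → 1 ≤ l → (σ : Fin l → Bool) → (ζ : NNF l) →
    ((eval σ ζ ≡ true) ⇔ (Switching l , switching σ ⊨ trP ζ))
    × ((Switching l , switching σ ⊨ trP ζ) ⇔ (¬ (Switching l , switching σ ⊨ trN ζ)))
    × ((eval σ ζ ≡ false) ⇔ (Switching l , switching σ ⊨ trN ζ))
    × ((Switching l , switching σ ⊨ trN ζ) ⇔ (¬ (Switching l , switching σ ⊨ trP ζ)))
lemma4p5 l _ σ ζ =
  let ⊨P = switching-⊨trP σ ζ
      ⊨N = switching-⊨trN σ ζ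
      (P⇔¬N , N⇔¬P) = complementary (eval σ ζ) ⊨P ⊨N
  in ⊨P ⇔-∘ ⇔-sym T-≡ , P⇔¬N , ⊨N ⇔-∘ ⇔-sym T-not-≡ , N⇔¬P
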